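{- Let $a(n,m)$ denote the number of Arndt compositions of $n$ with exactly $m$ parts. For every fixed positive integer $m$, as $n\to\infty$, $$a(n,m)\sim \frac{n^{m-1}}{2^{\lfloor m/2\rfloor}(m-1)!}.$$
   Context: A composition of $n$ is a finite sequence $(\sigma_1,\dots,\sigma_\ell)$ of positive integers summing to $n$. An Arndt composition is one with $\sigma_{2i-1}>\sigma_{2i}$ for every positive integer $i$ with $2i\le\ell$. -}

module Defs where

open import Data.Nat using (ℕ; zero; suc; _+_; _*_; _∸_; _<ᵇ_)
open import Data.Bool using (Bool; true; false; _∧_; if_then_else_)
open import Data.List using (List; []; _∷_; map; concatMap; length; upTo)

compositions : ℕ → ℕ → List (List ℕ)
compositions zero    zero    = [] ∷ []
compositions (suc n) zero    = []
compositions n       (suc m) =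
  concatMap (λ i → map (suc i ∷_) (compositions (n ∸ suc i) m)) (upTo n)

isArndt : List ℕ → Bool
isArndt (x ∷ y ∷ rest) = (y <ᵇ x) ∧ isArndt rest
isArndt _              = true

count : {A : Set} → (A → Bool) → List A → ℕ
count p []       = 0
count p (x ∷ xs) = if p x then suc (count p xs) else count p xs

a : ℕ → ℕ → ℕ
a n m = count isArndt (compositions n m)

-- Write c(n, m) for the number of all compositions of n into m parts.  Splitting
-- off the first two parts gives c(n, m + 2) = ∑ₛ s · c(n − 1 − s, m) and
-- a(n, m + 2) = ∑ₛ ⌊s/2⌋ · a(n − 1 − s, m).  Since s − 1 ≤ 2⌊s/2⌋ ≤ s, induction
-- on m squeezes 2^⌊m/2⌋ a(n, m) between c(n − ⌊m/2⌋, m) and c(n, m).  Telescoping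
-- with u^(d+1) + (d+1)u^d ≤ (u+1)^(d+1) ≤ u^(d+1) + (d+1)(u+1)^d puts d! c(n, d+1)
-- between (n − d)^d and n^d.  Hence 2^⌊m/2⌋ (m−1)! a(n, m) lies between (n − C)^(m−1)
-- and n^(m−1) for a constant C, and these differ by O(n^(m−2)).

module Submission where

open import Defs
open import Data.Bool using (Bool; true; false; _∧_; if_then_else_; T)
open import Data.List using (List; []; _∷_; map; concatMap; upTo; applyUpTo; _++_)
open import Data.Nat using (ℕ; zero; suc; _+_; _*_; _∸_; _^_; _≤_; _<_; _/_; ∣_-_∣; _!; z≤n; s≤s; _<ᵇ_; _≤ᵇ_; ⌊_/2⌋; ⌈_/2⌉)
open import Data.Nat.Properties
open import Data.Nat.DivMod using (m/n≡1+[m∸n]/n)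
open import Data.Nat.Tactic.RingSolver using (solve-∀)
open import Data.Product using (∃-syntax; _,_)
open import Relation.Binary.PropositionalEquality
open import Relation.Nullary using (yes; no)
open import Relation.Nullary.Reflects using (det; fromEquivalence)

∑ : ℕ → (ℕ → ℕ) → ℕ
∑ zero    f = 0
∑ (suc n) f = f 0 + ∑ n (λ i → f (suc i))

syntax ∑ n (λ i → f) = ∑[ i < n ] f

∑-cong : ∀ n {f g} → (∀ {i} → i < n → f i ≡ g i) → ∑ n f ≡ ∑ n g
∑-cong zero    eq = refl
∑-cong (suc n) eq = cong₂ _+_ (eq (s≤s z≤n)) (∑-cong n (λ i<n → eq (s≤s i<n)))

∑-mono-≤ : ∀ n {f g} → (∀ {i} → i < n → f i ≤ g i) → ∑ n f ≤ ∑ n g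
∑-mono-≤ zero    le = z≤n
∑-mono-≤ (suc n) le = +-mono-≤ (le (s≤s z≤n)) (∑-mono-≤ n (λ i<n → le (s≤s i<n)))

∑-monoˡ-≤ : ∀ f {m n} → m ≤ n → ∑ m f ≤ ∑ n f
∑-monoˡ-≤ f {zero}        _         = z≤n
∑-monoˡ-≤ f {suc m} {suc n} (s≤s m≤n) = +-monoʳ-≤ (f 0) (∑-monoˡ-≤ (λ i → f (suc i)) m≤n)

∑-*ˡ : ∀ n c f → ∑[ i < n ] (c * f i) ≡ c * ∑ n f
∑-*ˡ zero    c f = sym (*-zeroʳ c)
∑-*ˡ (suc n) c f = trans (cong (c * f 0 +_) (∑-*ˡ n c (λ i → f (suc i)))) (sym (*-distribˡ-+ c (f 0) _))

∑-*ʳ : ∀ n c f → ∑[ i < n ] (f i * c) ≡ ∑ n f * c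
∑-*ʳ n c f = trans (∑-cong n (λ {i} _ → *-comm (f i) c)) (trans (∑-*ˡ n c f) (*-comm c _))

∑-const : ∀ n c → ∑[ i < n ] c ≡ n * c
∑-const zero    c = refl
∑-const (suc n) c = cong (c +_) (∑-const n c)

∑-suc : ∀ n f → ∑ (suc n) f ≡ ∑ n f + f n
∑-suc zero    f = +-comm (f 0) 0
∑-suc (suc n) f = trans (cong (f 0 +_) (∑-suc n (λ i → f (suc i)))) (sym (+-assoc (f 0) _ _))

∑-reverse : ∀ n f → ∑[ i < n ] f (n ∸ suc i) ≡ ∑ n f
∑-reverse zero    f = refl
∑-reverse (suc n) f = trans (trans (cong (f n +_) (∑-reverse n f)) (+-comm (f n) _)) (sym (∑-suc n f))

∑-+ : ∀ n f g → ∑[ i < n ] (f i + g i) ≡ ∑ n f + ∑ n g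
∑-+ zero    f g = refl
∑-+ (suc n) f g = trans (cong (f 0 + g 0 +_) (∑-+ n (λ i → f (suc i)) (λ i → g (suc i)))) (interchange (f 0) (g 0) _ _)
  where
  interchange : ∀ a b c d → a + b + (c + d) ≡ a + c + (b + d)
  interchange = solve-∀

∑-triangle : ∀ n (φ : ℕ → ℕ → ℕ) →
  ∑[ i < n ] ∑[ j < n ∸ suc i ] φ i j ≡ ∑[ s < n ] ∑[ i < s ] φ i (s ∸ suc i)
∑-triangle zero    φ = refl
∑-triangle (suc n) φ = begin
    ∑ n (φ 0) + ∑[ i < n ] ∑[ j < n ∸ suc i ] φ (suc i) j
  ≡⟨ cong (∑ n (φ 0) +_) (∑-triangle n (λ i → φ (suc i))) ⟩
    ∑ n (φ 0) + ∑[ s < n ] ∑[ i < s ] φ (suc i) (s ∸ suc i)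
  ≡⟨ sym (∑-+ n (φ 0) (λ s → ∑[ i < s ] φ (suc i) (s ∸ suc i))) ⟩
    ∑[ s < n ] (φ 0 s + ∑[ i < s ] φ (suc i) (s ∸ suc i))
  ∎
  where open ≡-Reasoning

𝟙 : Bool → ℕ
𝟙 b = if b then 1 else 0

count-++ : ∀ {A : Set} (p : A → Bool) xs ys → count p (xs ++ ys) ≡ count p xs + count p ys
count-++ p []       ys = refl
count-++ p (x ∷ xs) ys with p x
... | true  = cong suc (count-++ p xs ys)
... | false = count-++ p xs ys

count-map : ∀ {A B : Set} (p : B → Bool) (h : A → B) xs → count p (map h xs) ≡ count (λ x → p (h x)) xs
count-map p h []       = refl
count-map p h (x ∷ xs) with p (h x)
... | true  = cong suc (count-map p h xs)
... | false = count-map p h xs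

count-concatMap : ∀ {A : Set} (p : A → Bool) (f : ℕ → List A) g n →
  count p (concatMap f (applyUpTo g n)) ≡ ∑[ i < n ] count p (f (g i))
count-concatMap p f g zero    = refl
count-concatMap p f g (suc n) =
  trans (count-++ p (f (g 0)) _) (cong (count p (f (g 0)) +_) (count-concatMap p f (λ i → g (suc i)) n))

count-∧ : ∀ {A : Set} b (p : A → Bool) xs → count (λ x → b ∧ p x) xs ≡ 𝟙 b * count p xs
count-∧ true  p xs = sym (+-identityʳ _)
count-∧ false p []       = refl
count-∧ false p (x ∷ xs) = count-∧ false p xs

nComp : ℕ → ℕ → ℕ
nComp n m = count (λ _ → true) (compositions n m)

count-compositions-suc : ∀ (p : List ℕ → Bool) n m →
  count p (compositions n (suc m)) ≡ ∑[ i < n ] count (λ σ → p (suc i ∷ σ)) (compositions (n ∸ suc i) m)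
count-compositions-suc p n m = begin
    count p (compositions n (suc m))
  ≡⟨ cong (count p) (unfold n) ⟩
    count p (concatMap (λ i → map (suc i ∷_) (compositions (n ∸ suc i) m)) (upTo n))
  ≡⟨ count-concatMap p _ (λ i → i) n ⟩
    ∑[ i < n ] count p (map (suc i ∷_) (compositions (n ∸ suc i) m))
  ≡⟨ ∑-cong n (λ {i} _ → count-map p (suc i ∷_) (compositions (n ∸ suc i) m)) ⟩
    ∑[ i < n ] count (λ σ → p (suc i ∷ σ)) (compositions (n ∸ suc i) m)
  ∎
  where
  open ≡-Reasoning
  unfold : ∀ n → compositions n (suc m) ≡ concatMap (λ i → map (suc i ∷_) (compositions (n ∸ suc i) m)) (upTo n)
  unfold zero    = refl
  unfold (suc n) = refl

nComp-suc : ∀ n m → nComp n (suc m) ≡ ∑[ i < n ] nComp (n ∸ suc i) m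
nComp-suc = count-compositions-suc (λ _ → true)

∑-pairs : ∀ n (ψ : ℕ → ℕ → ℕ) (F : ℕ → ℕ) →
  ∑[ i < n ] ∑[ j < n ∸ suc i ] (ψ i j * F (n ∸ suc i ∸ suc j))
    ≡ ∑[ s < n ] ((∑[ i < s ] ψ i (s ∸ suc i)) * F (n ∸ suc s))
∑-pairs n ψ F = trans (∑-triangle n _) (∑-cong n λ {s} _ → trans (∑-cong s (λ {i} → same-rest s i)) (∑-*ʳ s _ _))
  where
  same-rest : ∀ s i → i < s → ψ i (s ∸ suc i) * F (n ∸ suc i ∸ suc (s ∸ suc i)) ≡ ψ i (s ∸ suc i) * F (n ∸ suc s)
  same-rest s i i<s = cong (λ r → ψ i (s ∸ suc i) * F r) (begin
      n ∸ suc i ∸ suc (s ∸ suc i)   ≡⟨ ∸-+-assoc n (suc i) _ ⟩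
      n ∸ (suc i + suc (s ∸ suc i)) ≡⟨ cong (n ∸_) (+-suc (suc i) _) ⟩
      n ∸ suc (suc i + (s ∸ suc i)) ≡⟨ cong (λ t → n ∸ suc t) (m+[n∸m]≡n i<s) ⟩
      n ∸ suc s                     ∎)
    where open ≡-Reasoning

count-compositions-suc-suc : ∀ (p : List ℕ → Bool) n m →
  count p (compositions n (suc (suc m)))
    ≡ ∑[ i < n ] ∑[ j < n ∸ suc i ] count (λ σ → p (suc i ∷ suc j ∷ σ)) (compositions (n ∸ suc i ∸ suc j) m)
count-compositions-suc-suc p n m =
  trans (count-compositions-suc p n (suc m))
        (∑-cong n λ {i} _ → count-compositions-suc (λ σ → p (suc i ∷ σ)) (n ∸ suc i) m)

nComp-suc-suc : ∀ n m → nComp n (suc (suc m)) ≡ ∑[ s < n ] (s * nComp (n ∸ suc s) m)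
nComp-suc-suc n m = begin
    nComp n (suc (suc m))
  ≡⟨ count-compositions-suc-suc (λ _ → true) n m ⟩
    ∑[ i < n ] ∑[ j < n ∸ suc i ] nComp (n ∸ suc i ∸ suc j) m
  ≡⟨ ∑-cong n (λ {i} _ → ∑-cong (n ∸ suc i) (λ _ → sym (*-identityˡ _))) ⟩
    ∑[ i < n ] ∑[ j < n ∸ suc i ] (1 * nComp (n ∸ suc i ∸ suc j) m)
  ≡⟨ ∑-pairs n (λ _ _ → 1) (λ r → nComp r m) ⟩
    ∑[ s < n ] ((∑[ i < s ] 1) * nComp (n ∸ suc s) m)
  ≡⟨ ∑-cong n (λ {s} _ → cong (_* nComp (n ∸ suc s) m) (trans (∑-const s 1) (*-identityʳ s))) ⟩
    ∑[ s < n ] (s * nComp (n ∸ suc s) m)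
  ∎
  where open ≡-Reasoning

𝟙-true : ∀ {b} → T b → 𝟙 b ≡ 1
𝟙-true {true} _ = refl

≤ᵇ-suc : ∀ m n → (suc m ≤ᵇ suc n) ≡ (m ≤ᵇ n)
≤ᵇ-suc zero    n = refl
≤ᵇ-suc (suc m) n = refl

∑-𝟙[s≤i+i]≡⌊s/2⌋ : ∀ s → ∑[ i < s ] 𝟙 (s ≤ᵇ i + i) ≡ ⌊ s /2⌋
∑-𝟙[s≤i+i]≡⌊s/2⌋ zero          = refl
∑-𝟙[s≤i+i]≡⌊s/2⌋ (suc zero)    = refl
∑-𝟙[s≤i+i]≡⌊s/2⌋ (suc (suc s)) = begin
    ∑[ i < suc s ] 𝟙 (suc (suc s) ≤ᵇ suc i + suc i)
  ≡⟨ ∑-cong (suc s) (λ {i} _ → cong 𝟙 (shift i)) ⟩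
    ∑[ i < suc s ] 𝟙 (s ≤ᵇ i + i)
  ≡⟨ ∑-suc s (λ i → 𝟙 (s ≤ᵇ i + i)) ⟩
    (∑[ i < s ] 𝟙 (s ≤ᵇ i + i)) + 𝟙 (s ≤ᵇ s + s)
  ≡⟨ cong₂ _+_ (∑-𝟙[s≤i+i]≡⌊s/2⌋ s) (𝟙-true (≤⇒≤ᵇ (m≤m+n s s))) ⟩
    ⌊ s /2⌋ + 1
  ≡⟨ +-comm ⌊ s /2⌋ 1 ⟩
    suc ⌊ s /2⌋
  ∎
  where
  open ≡-Reasoning
  shift : ∀ i → (suc (suc s) ≤ᵇ suc i + suc i) ≡ (s ≤ᵇ i + i)
  shift i = trans (cong (λ t → suc (suc s) ≤ᵇ suc t) (+-suc i i)) (trans (≤ᵇ-suc (suc s) (suc (i + i))) (≤ᵇ-suc s (i + i)))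

<ᵇ-as-≤ᵇ : ∀ i k → (k <ᵇ i) ≡ (suc i + k ≤ᵇ i + i)
<ᵇ-as-≤ᵇ i k = det (<ᵇ-reflects-< k i) (fromEquivalence sound complete)
  where
  sound : T (suc i + k ≤ᵇ i + i) → k < i
  sound h = +-cancelˡ-≤ i (suc k) i (subst (_≤ i + i) (sym (+-suc i k)) (≤ᵇ⇒≤ _ _ h))
  complete : k < i → T (suc i + k ≤ᵇ i + i)
  complete k<i = ≤⇒≤ᵇ (subst (_≤ i + i) (+-suc i k) (+-monoʳ-≤ i k<i))

-- Of the s pairs (i + 1, s − i) of leading parts with sum s + 1, exactly ⌊s/2⌋ are Arndt.
arndtPairs≡⌊s/2⌋ : ∀ s → ∑[ i < s ] 𝟙 (s ∸ suc i <ᵇ i) ≡ ⌊ s /2⌋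
arndtPairs≡⌊s/2⌋ s = trans (∑-cong s (λ {i} i<s → cong 𝟙 (trans (<ᵇ-as-≤ᵇ i _) (cong (_≤ᵇ i + i) (m+[n∸m]≡n i<s)))))
                           (∑-𝟙[s≤i+i]≡⌊s/2⌋ s)

a-suc-suc : ∀ n m → a n (suc (suc m)) ≡ ∑[ s < n ] (⌊ s /2⌋ * a (n ∸ suc s) m)
a-suc-suc n m = begin
    a n (suc (suc m))
  ≡⟨ count-compositions-suc-suc isArndt n m ⟩
    ∑[ i < n ] ∑[ j < n ∸ suc i ] count (λ σ → (j <ᵇ i) ∧ isArndt σ) (compositions (n ∸ suc i ∸ suc j) m)
  ≡⟨ ∑-cong n (λ {i} _ → ∑-cong (n ∸ suc i) (λ {j} _ → count-∧ (j <ᵇ i) isArndt (compositions (n ∸ suc i ∸ suc j) m))) ⟩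
    ∑[ i < n ] ∑[ j < n ∸ suc i ] (𝟙 (j <ᵇ i) * a (n ∸ suc i ∸ suc j) m)
  ≡⟨ ∑-pairs n (λ i j → 𝟙 (j <ᵇ i)) (λ r → a r m) ⟩
    ∑[ s < n ] ((∑[ i < s ] 𝟙 (s ∸ suc i <ᵇ i)) * a (n ∸ suc s) m)
  ≡⟨ ∑-cong n (λ {s} _ → cong (_* a (n ∸ suc s) m) (arndtPairs≡⌊s/2⌋ s)) ⟩
    ∑[ s < n ] (⌊ s /2⌋ * a (n ∸ suc s) m)
  ∎
  where open ≡-Reasoning

count-compositions-zero : ∀ (p q : List ℕ → Bool) n → p [] ≡ q [] →
  count p (compositions n 0) ≡ count q (compositions n 0)
count-compositions-zero p q zero    eq rewrite eq = refl
count-compositions-zero p q (suc n) eq = refl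

a-zero : ∀ n → a n 0 ≡ nComp n 0
a-zero n = count-compositions-zero isArndt (λ _ → true) n refl

a-one : ∀ n → a n 1 ≡ nComp n 1
a-one n = trans (count-compositions-suc isArndt n 0)
         (trans (∑-cong n (λ {i} _ → count-compositions-zero (λ σ → isArndt (suc i ∷ σ)) (λ _ → true) (n ∸ suc i) refl))
                (sym (count-compositions-suc (λ _ → true) n 0)))

⌊n/2⌋+⌊n/2⌋≤n : ∀ n → ⌊ n /2⌋ + ⌊ n /2⌋ ≤ n
⌊n/2⌋+⌊n/2⌋≤n n = ≤-trans (+-monoʳ-≤ ⌊ n /2⌋ (⌊n/2⌋≤⌈n/2⌉ n)) (≤-reflexive (⌊n/2⌋+⌈n/2⌉≡n n))

n≤⌈n/2⌉+⌈n/2⌉ : ∀ n → n ≤ ⌈ n /2⌉ + ⌈ n /2⌉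
n≤⌈n/2⌉+⌈n/2⌉ n = ≤-trans (≤-reflexive (sym (⌊n/2⌋+⌈n/2⌉≡n n))) (+-monoˡ-≤ ⌈ n /2⌉ (⌊n/2⌋≤⌈n/2⌉ n))

∸-comm : ∀ m n o → m ∸ n ∸ o ≡ m ∸ o ∸ n
∸-comm m n o = trans (∸-+-assoc m n o) (trans (cong (m ∸_) (+-comm n o)) (sym (∸-+-assoc m o n)))

2^⌊m/2⌋*a-suc-suc : ∀ n m → 2 ^ suc ⌊ m /2⌋ * a n (suc (suc m))
  ≡ ∑[ s < n ] ((⌊ s /2⌋ + ⌊ s /2⌋) * (2 ^ ⌊ m /2⌋ * a (n ∸ suc s) m))
2^⌊m/2⌋*a-suc-suc n m = begin
    2 ^ suc h * a n (suc (suc m))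
  ≡⟨ cong (2 ^ suc h *_) (a-suc-suc n m) ⟩
    2 ^ suc h * ∑[ s < n ] (⌊ s /2⌋ * a (n ∸ suc s) m)
  ≡⟨ sym (∑-*ˡ n (2 ^ suc h) _) ⟩
    ∑[ s < n ] (2 ^ suc h * (⌊ s /2⌋ * a (n ∸ suc s) m))
  ≡⟨ ∑-cong n (λ {s} _ → regroup (2 ^ h) ⌊ s /2⌋ (a (n ∸ suc s) m)) ⟩
    ∑[ s < n ] ((⌊ s /2⌋ + ⌊ s /2⌋) * (2 ^ h * a (n ∸ suc s) m))
  ∎
  where
  open ≡-Reasoning
  h = ⌊ m /2⌋
  regroup : ∀ x v y → 2 * x * (v * y) ≡ (v + v) * (x * y)
  regroup = solve-∀

2^⌊m/2⌋*a≤nComp : ∀ m n → 2 ^ ⌊ m /2⌋ * a n m ≤ nComp n m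
2^⌊m/2⌋*a≤nComp zero          n = ≤-reflexive (trans (+-identityʳ _) (a-zero n))
2^⌊m/2⌋*a≤nComp (suc zero)    n = ≤-reflexive (trans (+-identityʳ _) (a-one n))
2^⌊m/2⌋*a≤nComp (suc (suc m)) n = begin
    2 ^ suc ⌊ m /2⌋ * a n (suc (suc m))
  ≡⟨ 2^⌊m/2⌋*a-suc-suc n m ⟩
    ∑[ s < n ] ((⌊ s /2⌋ + ⌊ s /2⌋) * (2 ^ ⌊ m /2⌋ * a (n ∸ suc s) m))
  ≤⟨ ∑-mono-≤ n (λ {s} _ → *-mono-≤ (⌊n/2⌋+⌊n/2⌋≤n s) (2^⌊m/2⌋*a≤nComp m (n ∸ suc s))) ⟩
    ∑[ s < n ] (s * nComp (n ∸ suc s) m)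
  ≡⟨ nComp-suc-suc n m ⟨
    nComp n (suc (suc m))
  ∎
  where open ≤-Reasoning

nComp-∸⌊m/2⌋≤2^⌊m/2⌋*a : ∀ m n → nComp (n ∸ ⌊ m /2⌋) m ≤ 2 ^ ⌊ m /2⌋ * a n m
nComp-∸⌊m/2⌋≤2^⌊m/2⌋*a zero          n = ≤-reflexive (sym (trans (+-identityʳ _) (a-zero n)))
nComp-∸⌊m/2⌋≤2^⌊m/2⌋*a (suc zero)    n = ≤-reflexive (sym (trans (+-identityʳ _) (a-one n)))
nComp-∸⌊m/2⌋≤2^⌊m/2⌋*a (suc (suc m)) zero     = z≤n
nComp-∸⌊m/2⌋≤2^⌊m/2⌋*a (suc (suc m)) (suc n) = begin
    nComp (n ∸ h) (suc (suc m))
  ≡⟨ nComp-suc-suc (n ∸ h) m ⟩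
    ∑[ s < n ∸ h ] (s * nComp (n ∸ h ∸ suc s) m)
  ≡⟨ ∑-cong (n ∸ h) (λ {s} _ → cong (λ r → s * nComp r m) (∸-comm n h (suc s))) ⟩
    ∑[ s < n ∸ h ] (s * nComp (n ∸ suc s ∸ h) m)
  ≤⟨ ∑-monoˡ-≤ (λ s → s * nComp (n ∸ suc s ∸ h) m) (m∸n≤m n h) ⟩
    ∑[ s < n ] (s * nComp (n ∸ suc s ∸ h) m)
  ≤⟨ ∑-mono-≤ n (λ {s} _ → *-mono-≤ (n≤⌈n/2⌉+⌈n/2⌉ s) (nComp-∸⌊m/2⌋≤2^⌊m/2⌋*a m (n ∸ suc s))) ⟩
    ∑[ s < n ] ((⌈ s /2⌉ + ⌈ s /2⌉) * (2 ^ h * a (n ∸ suc s) m))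
  -- the s = 0 summand is 0, and ⌊ suc s /2⌋ is ⌈ s /2⌉ by definition
  ≡⟨ 2^⌊m/2⌋*a-suc-suc (suc n) m ⟨
    2 ^ suc h * a (suc n) (suc (suc m))
  ∎
  where
  open ≤-Reasoning
  h = ⌊ m /2⌋

bernoulli : ∀ d c u → u ^ suc d + suc d * c * u ^ d ≤ (c + u) ^ suc d
bernoulli zero    c u = ≤-reflexive (linear c u)
  where
  linear : ∀ c u → u * 1 + 1 * c * 1 ≡ (c + u) * 1
  linear = solve-∀
bernoulli (suc d) c u = begin
    u * (u * u ^ d) + (2 + d) * c * (u * u ^ d)
  ≤⟨ m≤m+n _ _ ⟩
    u * (u * u ^ d) + (2 + d) * c * (u * u ^ d) + (1 + d) * c * c * u ^ d
  ≡⟨ expand c u (u ^ d) d ⟩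
    (c + u) * (u * u ^ d + (1 + d) * c * u ^ d)
  ≤⟨ *-monoʳ-≤ (c + u) (bernoulli d c u) ⟩
    (c + u) * (c + u) ^ suc d
  ∎
  where
  open ≤-Reasoning
  expand : ∀ c u P d → u * (u * P) + (2 + d) * c * (u * P) + (1 + d) * c * c * P ≡ (c + u) * (u * P + (1 + d) * c * P)
  expand = solve-∀

bernoulli-reverse : ∀ d c u → (c + u) ^ suc d ≤ u ^ suc d + suc d * c * (c + u) ^ d
bernoulli-reverse zero    c u = ≤-reflexive (linear c u)
  where
  linear : ∀ c u → (c + u) * 1 ≡ u * 1 + 1 * c * 1
  linear = solve-∀
bernoulli-reverse (suc d) c u = begin
    (c + u) * (c + u) ^ suc d
  ≤⟨ *-monoʳ-≤ (c + u) (bernoulli-reverse d c u) ⟩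
    (c + u) * (u ^ suc d + suc d * c * (c + u) ^ d)
  ≡⟨ expand c u (u ^ suc d) ((c + u) ^ d) d ⟩
    u * u ^ suc d + c * u ^ suc d + suc d * c * ((c + u) * (c + u) ^ d)
  ≤⟨ +-monoˡ-≤ _ (+-monoʳ-≤ (u * u ^ suc d) (*-monoʳ-≤ c (^-monoˡ-≤ (suc d) (m≤n+m u c)))) ⟩
    u * u ^ suc d + c * ((c + u) * (c + u) ^ d) + suc d * c * ((c + u) * (c + u) ^ d)
  ≡⟨ collect c u (u ^ suc d) ((c + u) ^ d) d ⟩
    u * u ^ suc d + suc (suc d) * c * ((c + u) * (c + u) ^ d)
  ∎
  where
  open ≤-Reasoning
  expand : ∀ c u Q P d → (c + u) * (Q + (1 + d) * c * P) ≡ u * Q + c * Q + (1 + d) * c * ((c + u) * P)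
  expand = solve-∀
  collect : ∀ c u Q P d → u * Q + c * ((c + u) * P) + (1 + d) * c * ((c + u) * P) ≡ u * Q + (2 + d) * c * ((c + u) * P)
  collect = solve-∀

telescope-≤ : ∀ (g f : ℕ → ℕ) → (∀ t → g (suc t) ≤ g t + f t) → ∀ n → g n ≤ g 0 + ∑ n f
telescope-≤ g f step zero    = m≤m+n (g 0) 0
telescope-≤ g f step (suc n) = begin
    g (suc n)         ≤⟨ step n ⟩
    g n + f n         ≤⟨ +-monoˡ-≤ (f n) (telescope-≤ g f step n) ⟩
    g 0 + ∑ n f + f n ≡⟨ +-assoc (g 0) _ _ ⟩
    g 0 + (∑ n f + f n) ≡⟨ cong (g 0 +_) (∑-suc n f) ⟨
    g 0 + ∑ (suc n) f ∎
  where open ≤-Reasoning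

telescope-≥ : ∀ (g f : ℕ → ℕ) → (∀ t → g t + f t ≤ g (suc t)) → ∀ n → g 0 + ∑ n f ≤ g n
telescope-≥ g f step zero    = ≤-reflexive (+-identityʳ (g 0))
telescope-≥ g f step (suc n) = begin
    g 0 + ∑ (suc n) f   ≡⟨ cong (g 0 +_) (∑-suc n f) ⟩
    g 0 + (∑ n f + f n) ≡⟨ +-assoc (g 0) _ _ ⟨
    g 0 + ∑ n f + f n   ≤⟨ +-monoˡ-≤ (f n) (telescope-≥ g f step n) ⟩
    g n + f n           ≤⟨ step n ⟩
    g (suc n)           ∎
  where open ≤-Reasoning

∑-powers : ∀ d n → suc d * ∑[ t < n ] (t ^ d) ≤ n ^ suc d
∑-powers d n = begin
    suc d * ∑[ t < n ] (t ^ d)     ≡⟨ ∑-*ˡ n (suc d) (_^ d) ⟨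
    ∑[ t < n ] (suc d * t ^ d)   ≤⟨ telescope-≥ (_^ suc d) (λ t → suc d * t ^ d) step n ⟩
    n ^ suc d                    ∎
  where
  open ≤-Reasoning
  step : ∀ t → t ^ suc d + suc d * t ^ d ≤ suc t ^ suc d
  step t = subst (λ k → t ^ suc d + k * t ^ d ≤ suc t ^ suc d) (*-identityʳ (suc d)) (bernoulli d 1 t)

nComp-one : ∀ n → nComp (suc n) 1 ≡ 1
nComp-one n = trans (nComp-suc (suc n) 0) (onlyLastPart n)
  where
  onlyLastPart : ∀ n → ∑[ i < suc n ] nComp (n ∸ i) 0 ≡ 1
  onlyLastPart zero    = refl
  onlyLastPart (suc n) = onlyLastPart n

!*nComp-suc : ∀ d n → suc d ! * nComp n (suc (suc d)) ≡ suc d * ∑[ t < n ] (d ! * nComp t (suc d))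
!*nComp-suc d n = begin
    suc d * d ! * nComp n (suc (suc d))
  ≡⟨ *-assoc (suc d) (d !) _ ⟩
    suc d * (d ! * nComp n (suc (suc d)))
  ≡⟨ cong (λ x → suc d * (d ! * x)) (nComp-suc n (suc d)) ⟩
    suc d * (d ! * ∑[ i < n ] nComp (n ∸ suc i) (suc d))
  ≡⟨ cong (suc d *_) (∑-*ˡ n (d !) _) ⟨
    suc d * ∑[ i < n ] (d ! * nComp (n ∸ suc i) (suc d))
  ≡⟨ cong (suc d *_) (∑-reverse n (λ t → d ! * nComp t (suc d))) ⟩
    suc d * ∑[ t < n ] (d ! * nComp t (suc d))
  ∎
  where open ≡-Reasoning

d!*nComp≤n^d : ∀ d n → d ! * nComp n (suc d) ≤ n ^ d
d!*nComp≤n^d zero    zero    = z≤n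
d!*nComp≤n^d zero    (suc n) = ≤-reflexive (trans (+-identityʳ _) (nComp-one n))
d!*nComp≤n^d (suc d) n = begin
    suc d ! * nComp n (suc (suc d))          ≡⟨ !*nComp-suc d n ⟩
    suc d * ∑[ t < n ] (d ! * nComp t (suc d)) ≤⟨ *-monoʳ-≤ (suc d) (∑-mono-≤ n (λ {t} _ → d!*nComp≤n^d d t)) ⟩
    suc d * ∑[ t < n ] (t ^ d)                ≤⟨ ∑-powers d n ⟩
    n ^ suc d                                ∎
  where open ≤-Reasoning

[n∸d]^d≤d!*nComp : ∀ d n → d < n → (n ∸ d) ^ d ≤ d ! * nComp n (suc d)
[n∸d]^d≤d!*nComp zero    (suc n) _ = ≤-reflexive (sym (trans (+-identityʳ _) (nComp-one n)))
[n∸d]^d≤d!*nComp (suc d) n       _ = begin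
    (n ∸ suc d) ^ suc d                          ≤⟨ telescope-≤ (λ t → (t ∸ suc d) ^ suc d) f step n ⟩
    ∑ n f                                        ≡⟨ ∑-*ˡ n (suc d) _ ⟩
    suc d * ∑[ t < n ] (d ! * nComp t (suc d))   ≡⟨ !*nComp-suc d n ⟨
    suc d ! * nComp n (suc (suc d))              ∎
  where
  open ≤-Reasoning
  f : ℕ → ℕ
  f t = suc d * (d ! * nComp t (suc d))
  step : ∀ t → (t ∸ d) ^ suc d ≤ (t ∸ suc d) ^ suc d + f t
  step t with d <? t
  ... | yes d<t = begin
      (t ∸ d) ^ suc d                       ≡⟨ cong (_^ suc d) (+-∸-assoc 1 d<t) ⟩
      (1 + u) ^ suc d                       ≤⟨ bernoulli-reverse d 1 u ⟩
      u ^ suc d + suc d * 1 * (1 + u) ^ d   ≡⟨ cong (λ k → u ^ suc d + k * (1 + u) ^ d) (*-identityʳ (suc d)) ⟩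
      u ^ suc d + suc d * (1 + u) ^ d       ≤⟨ +-monoʳ-≤ (u ^ suc d) (*-monoʳ-≤ (suc d) (subst (λ x → x ^ d ≤ d ! * nComp t (suc d)) (+-∸-assoc 1 d<t) ([n∸d]^d≤d!*nComp d t d<t))) ⟩
      u ^ suc d + f t                       ∎
    where
    u = t ∸ suc d
  ... | no d≮t rewrite m≤n⇒m∸n≡0 (≮⇒≥ d≮t) = z≤n

n/2≡⌊n/2⌋ : ∀ n → n / 2 ≡ ⌊ n /2⌋
n/2≡⌊n/2⌋ zero          = refl
n/2≡⌊n/2⌋ (suc zero)    = refl
n/2≡⌊n/2⌋ (suc (suc n)) = trans (m/n≡1+[m∸n]/n {suc (suc n)} {2} (s≤s (s≤s z≤n))) (cong suc (n/2≡⌊n/2⌋ n))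

normalisedArndt : ℕ → ℕ → ℕ
normalisedArndt d n = a n (suc d) * 2 ^ ⌊ suc d /2⌋ * d !

normalisedArndt≤n^d : ∀ d n → normalisedArndt d n ≤ n ^ d
normalisedArndt≤n^d d n = begin
    a n (suc d) * 2 ^ ⌊ suc d /2⌋ * d !   ≡⟨ rearrange (a n (suc d)) (2 ^ ⌊ suc d /2⌋) (d !) ⟩
    d ! * (2 ^ ⌊ suc d /2⌋ * a n (suc d)) ≤⟨ *-monoʳ-≤ (d !) (2^⌊m/2⌋*a≤nComp (suc d) n) ⟩
    d ! * nComp n (suc d)                  ≤⟨ d!*nComp≤n^d d n ⟩
    n ^ d                                  ∎
  where
  open ≤-Reasoning
  rearrange : ∀ x y z → x * y * z ≡ z * (y * x)
  rearrange = solve-∀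

[n∸c]^d≤normalisedArndt : ∀ d n → ⌊ suc d /2⌋ + d < n → (n ∸ (⌊ suc d /2⌋ + d)) ^ d ≤ normalisedArndt d n
[n∸c]^d≤normalisedArndt d n h+d<n = begin
    (n ∸ (h + d)) ^ d            ≡⟨ cong (_^ d) (∸-+-assoc n h d) ⟨
    (n ∸ h ∸ d) ^ d              ≤⟨ [n∸d]^d≤d!*nComp d (n ∸ h) d<n∸h ⟩
    d ! * nComp (n ∸ h) (suc d)  ≤⟨ *-monoʳ-≤ (d !) (nComp-∸⌊m/2⌋≤2^⌊m/2⌋*a (suc d) n) ⟩
    d ! * (2 ^ h * a n (suc d))  ≡⟨ rearrange (a n (suc d)) (2 ^ h) (d !) ⟨
    a n (suc d) * 2 ^ h * d !    ∎
  where
  open ≤-Reasoning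
  h = ⌊ suc d /2⌋
  d<n∸h : d < n ∸ h
  d<n∸h = subst (_≤ n ∸ h) (m+n∸m≡n h (suc d)) (∸-monoˡ-≤ h (subst (_≤ n) (sym (+-suc h d)) h+d<n))
  rearrange : ∀ x y z → x * y * z ≡ z * (y * x)
  rearrange = solve-∀

n*∣x-n^d∣≤d*c*n^d : ∀ d c n x → c ≤ n → (n ∸ c) ^ d ≤ x → x ≤ n ^ d → n * ∣ x - n ^ d ∣ ≤ d * c * n ^ d
n*∣x-n^d∣≤d*c*n^d d c n x c≤n lower upper rewrite m≤n⇒∣m-n∣≡n∸m upper = bound d lower
  where
  bound : ∀ d → (n ∸ c) ^ d ≤ x → n * (n ^ d ∸ x) ≤ d * c * n ^ d
  bound zero    1≤x rewrite m≤n⇒m∸n≡0 1≤x | *-zeroʳ n = z≤n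
  bound (suc e) u^d≤x = begin
      n * (n ^ suc e ∸ x)               ≤⟨ *-monoʳ-≤ n (∸-monoʳ-≤ (n ^ suc e) u^d≤x) ⟩
      n * (n ^ suc e ∸ u ^ suc e)       ≤⟨ *-monoʳ-≤ n (m≤n+o⇒m∸n≤o (n ^ suc e) (u ^ suc e) gap) ⟩
      n * (suc e * c * n ^ e)           ≡⟨ rearrange n (suc e * c) (n ^ e) ⟩
      suc e * c * (n * n ^ e)           ∎
    where
    open ≤-Reasoning
    u = n ∸ c
    gap : n ^ suc e ≤ u ^ suc e + suc e * c * n ^ e
    gap = subst (λ k → k ^ suc e ≤ u ^ suc e + suc e * c * k ^ e) (m+[n∸m]≡n c≤n) (bernoulli-reverse e c u)
    rearrange : ∀ x y z → x * (y * z) ≡ y * (x * z)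
    rearrange = solve-∀

n*x≤k*y⇒q*k<n⇒q*x≤y : ∀ {q k x y} n → n * x ≤ k * y → q * k < n → q * x ≤ y
n*x≤k*y⇒q*k<n⇒q*x≤y {q} {k} {x} {y} n@(suc _) nx≤ky qk<n = *-cancelˡ-≤ n (begin
    n * (q * x)   ≡⟨ rearrange n q x ⟩
    q * (n * x)   ≤⟨ *-monoʳ-≤ q nx≤ky ⟩
    q * (k * y)   ≡⟨ *-assoc q k y ⟨
    q * k * y     ≤⟨ *-monoˡ-≤ y (<⇒≤ qk<n) ⟩
    n * y         ∎)
  where
  open ≤-Reasoning
  rearrange : ∀ x y z → x * (y * z) ≡ y * (x * z)
  rearrange = solve-∀

corollary2p5 : (m : ℕ) → 1 ≤ m → (p q : ℕ) → 1 ≤ p → 1 ≤ q →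
    ∃[ N ] ((n : ℕ) → N ≤ n →
    q * ∣ a n m * (2 ^ (m / 2)) * ((m ∸ 1) !) - n ^ (m ∸ 1) ∣ ≤ p * n ^ (m ∸ 1))
corollary2p5 (suc d) _ p q 1≤p _ = suc (q * (d * c) + c) , bound
  where
  c = ⌊ suc d /2⌋ + d
  bound : (n : ℕ) → suc (q * (d * c) + c) ≤ n → q * ∣ a n (suc d) * 2 ^ (suc d / 2) * d ! - n ^ d ∣ ≤ p * n ^ d
  bound n N≤n rewrite n/2≡⌊n/2⌋ (suc d) = begin
      q * ∣ a n (suc d) * 2 ^ ⌊ suc d /2⌋ * d ! - n ^ d ∣
    ≤⟨ n*x≤k*y⇒q*k<n⇒q*x≤y {q} {d * c} n
         (n*∣x-n^d∣≤d*c*n^d d c n _ (<⇒≤ c<n) ([n∸c]^d≤normalisedArndt d n c<n) (normalisedArndt≤n^d d n))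
         (≤-trans (s≤s (m≤m+n (q * (d * c)) c)) N≤n) ⟩
      n ^ d
    ≤⟨ subst (_≤ p * n ^ d) (*-identityˡ (n ^ d)) (*-monoˡ-≤ (n ^ d) 1≤p) ⟩
      p * n ^ d
    ∎
    where
    open ≤-Reasoning
    c<n : c < n
    c<n = ≤-trans (s≤s (m≤n+m c (q * (d * c)))) N≤n
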